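{- Let $r>k\geq 1$ be integers with $k\geq (r-1)/2$. Then $\mathrm{tc}_{r,k}(K_n)\leq r-k$ for all $n\geq 1$.
   Context: For integers $r\geq k\geq 1$, an $(r,k)$-colouring of a graph $G$ is a function $\varphi:E(G)\to\binom{[r]}{k}$, assigning to each edge a set of exactly $k$ colours from $[r]=\{1,\dots,r\}$. A subgraph $H\subseteq G$ is monochromatic if there is a colour $i$ belonging to $\varphi(e)$ for every $e\in E(H)$. $\mathrm{tc}(G,\varphi)$ is the minimum number of monochromatic trees (a single vertex counts as a tree) whose union covers $V(G)$, and $\mathrm{tc}_{r,k}(G)$ is the minimum $m$ such that every $(r,k)$-colouring $\varphi$ of $G$ satisfies $\mathrm{tc}(G,\varphi)\leq m$. -}

module Defs where

open import Data.Nat using (ℕ; _≤_)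
open import Data.Fin using (Fin)
open import Data.Fin.Subset using (Subset; _∈_; ∣_∣)
open import Data.List using (List; []; _∷_; [_]; length)
open import Data.List.Relation.Unary.Any using (Any)
open import Data.List.Relation.Unary.All using (All)
open import Data.Product using (Σ; _×_; ∃)
open import Relation.Binary.PropositionalEquality using (_≡_; _≢_)
open import Relation.Nullary using (¬_)
import Data.List.Membership.Propositional as LM

record Colouring (r k n : ℕ) : Set where
  field
    col  : Fin n → Fin n → Subset r
    sym  : ∀ u v → col u v ≡ col v u
    size : ∀ u v → u ≢ v → ∣ col u v ∣ ≡ k
open Colouring public

data MonoTree {r k n : ℕ} (φ : Colouring r k n) (i : Fin r) : List (Fin n) → Set where
  single : (v : Fin n) → MonoTree φ i [ v ]
  grow   : ∀ {vs} (u v : Fin n) → MonoTree φ i vs → u LM.∈ vs → ¬ (v LM.∈ vs) →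
           i ∈ col φ u v → MonoTree φ i (v ∷ vs)

record MonoTreeIn {r k n : ℕ} (φ : Colouring r k n) : Set where
  constructor mkTree
  field
    colour   : Fin r
    vertices : List (Fin n)
    tree     : MonoTree φ colour vertices
open MonoTreeIn public

Covers : {r k n : ℕ} (φ : Colouring r k n) → List (MonoTreeIn φ) → Set
Covers {n = n} φ ts = (x : Fin n) → Any (λ T → x LM.∈ vertices T) ts

tc≤ : {r k n : ℕ} (φ : Colouring r k n) → ℕ → Set
tc≤ φ m = Σ (List (MonoTreeIn φ)) (λ ts → length ts ≤ m × Covers φ ts)

tcK≤ : (r k n m : ℕ) → Set
tcK≤ r k n m = (φ : Colouring r k n) → tc≤ φ m

module Submission where

-- Fix a vertex v.  For a colour c, the c-ball of radius d around v is a monochromatic tree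
-- containing every vertex reached from v by a c-walk of length at most d.  Put m = r - k and
-- take the radius-2 balls of the m lowest and of the m highest colours.  If neither family
-- covers K_n, some u₀ is missed by the first and some u₁ by the second.  A colour of either
-- family then lies on at most one of the edges vu₀, vu₁, u₀u₁ (two of them would give a walk
-- of length at most 2 to a missed vertex), while every edge carries k colours; hence
-- 3k + 2|F| ≤ 3r for the union F of the two families.  If m ≤ k the families are disjoint,
-- |F| = 2m, and this is impossible; otherwise m = k + 1, F contains every colour, and
-- 3k ≤ r = 2k + 1 forces r = 3, k = 1.  In that case each edge has exactly one colour: if no
-- two of the three colours' radius-3 balls around v cover, the three missed vertices pin down
-- enough edge colours for the colour-0 balls around v and around one of them to cover.

open import Defs
open import Data.Bool using (Bool; true; false; T; not; _∨_)
open import Data.Bool.Properties using (T-≡; T-∨)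
open import Data.Empty using (⊥; ⊥-elim)
open import Data.Fin using (Fin; zero; suc; toℕ)
open import Data.Fin.Patterns using (0F; 1F; 2F)
import Data.Fin.Properties as Fin
open import Data.Fin.Subset using (Subset; ∣_∣) renaming (_∈_ to _∈ˢ_; _∉_ to _∉ˢ_)
import Data.Fin.Subset.Properties as Subset
open import Data.List using (List; []; _∷_; [_]; map; allFin; tabulate; filter; length)
open import Data.List.Properties using (length-map)
open import Data.List.Relation.Unary.Any using (Any; here; there; any?)
open import Data.List.Relation.Unary.Any.Properties using (map⁺)
open import Data.List.Membership.Propositional using (_∈_; find; lose)
open import Data.List.Membership.Propositional.Properties using (∈-allFin; ∈-filter⁺)
import Data.List.Membership.DecPropositional as DecMembership
open import Data.List.Relation.Binary.Subset.Propositional using (_⊆_)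
open import Data.Nat using (ℕ; zero; suc; _+_; _*_; _∸_; _≤_; _<_; _<ᵇ_; z≤n; s≤s; _≤?_; _<?_; _≟_)
open import Data.Nat.Properties
  using ( +-*-semiring; module ≤-Reasoning; ≤-refl; ≤-trans; ≤-reflexive; ≤-antisym; <⇒≤; <-trans
        ; ≰⇒>; <⇒≱; <⇒<ᵇ; <ᵇ⇒<; m<n⇒n≢0; +-mono-≤; +-monoˡ-≤; *-monoʳ-≤; +-cancelˡ-≤; +-cancelʳ-≤
        ; *-zeroʳ; *-identityʳ; *-comm; m<m+n; m≤n+m; m≤n+m∸n; m<n⇒0<n∸m; m+[n∸m]≡n )
open import Algebra.Properties.Semiring.Sum +-*-semiring using (sum; ∑-distrib-+; *-distribˡ-sum)
open import Data.Product using (∃; _×_; _,_; proj₁; proj₂)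
open import Data.Sum using (_⊎_; inj₁; inj₂)
open import Data.Vec using (lookup; _∷_; [])
open import Data.Vec.Properties using (lookup⇒[]=)
open import Data.Nat.Tactic.RingSolver using (solve-∀)
open import Function using (id; _∘_)
open import Function.Bundles using (Equivalence)
open import Relation.Nullary using (¬_; Dec; yes; no; contradiction)
open import Relation.Nullary.Decidable using (T?)
open import Relation.Binary.PropositionalEquality
  using (_≡_; _≢_; refl; cong; cong₂; subst; trans)
  renaming (sym to ≡-sym)

module _ {r k n : ℕ} (φ : Colouring r k n) (c : Fin r) where

  open DecMembership (Fin._≟_ {n}) using (_∈?_)

  -- Joined includes u ≡ w, so walks may pause; this spares distinctness side conditions.
  Joined : Fin n → Fin n → Set
  Joined u w = u ≡ w ⊎ c ∈ˢ col φ u w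

  joined-sym : ∀ {u w} → Joined u w → Joined w u
  joined-sym (inj₁ refl) = inj₁ refl
  joined-sym {u} {w} (inj₂ c∈uw) = inj₂ (subst (c ∈ˢ_) (sym φ u w) c∈uw)

  infixl 5 _▸_
  data Reachable (v : Fin n) : ℕ → Fin n → Set where
    start : ∀ {d} → Reachable v d v
    _▸_   : ∀ {d u w} → Reachable v d u → Joined u w → Reachable v (suc d) w

  record Enlargement (vs ws : List (Fin n)) : Set where
    field
      {enlarged} : List (Fin n)
      tree       : MonoTree φ c enlarged
      ⊇-original : vs ⊆ enlarged
      ⊇-joined   : ∀ {u w} → w ∈ ws → u ∈ vs → c ∈ˢ col φ u w → w ∈ enlarged
  open Enlargement

  enlarge : ∀ {vs} → MonoTree φ c vs → (ws : List (Fin n)) → Enlargement vs ws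
  enlarge t [] = record { tree = t ; ⊇-original = id ; ⊇-joined = λ () }
  enlarge {vs} t (w ∷ ws) with w ∈? vs | any? (λ u → c Subset.∈? col φ u w) vs
  ... | yes w∈vs | _ = let E = enlarge t ws in record
    { tree = tree E
    ; ⊇-original = ⊇-original E
    ; ⊇-joined = λ { (here refl) _ _ → ⊇-original E w∈vs ; (there w∈ws) → ⊇-joined E w∈ws } }
  ... | no w∉vs | yes joined =
    let u , u∈vs , cuw = find joined
        E = enlarge (grow u w t u∈vs w∉vs cuw) ws
    in record
      { tree = tree E
      ; ⊇-original = ⊇-original E ∘ there
      ; ⊇-joined = λ { (here refl) _ _ → ⊇-original E (here refl)
                     ; (there w∈ws) u∈vs → ⊇-joined E w∈ws (there u∈vs) } }
  ... | no _ | no unjoined = let E = enlarge t ws in record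
    { tree = tree E
    ; ⊇-original = ⊇-original E
    ; ⊇-joined = λ { (here refl) u∈vs cuw → ⊥-elim (unjoined (lose u∈vs cuw))
                   ; (there w∈ws) → ⊇-joined E w∈ws } }

  private
    grownBall : ℕ → Fin n → ∃ (MonoTree φ c)
    layer     : ∀ d v → Enlargement (proj₁ (grownBall d v)) (allFin n)

    grownBall zero    v = [ v ] , single v
    grownBall (suc d) v = enlarged (layer d v) , tree (layer d v)

    layer d v = enlarge (proj₂ (grownBall d v)) (allFin n)

  ball : ℕ → Fin n → MonoTreeIn φ
  ball d v = mkTree c (proj₁ (grownBall d v)) (proj₂ (grownBall d v))

  centre∈ball : ∀ d v → v ∈ vertices (ball d v)
  centre∈ball zero    v = here refl
  centre∈ball (suc d) v = ⊇-original (layer d v) (centre∈ball d v)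

  reachable⇒∈ball : ∀ {d v w} → Reachable v d w → w ∈ vertices (ball d v)
  reachable⇒∈ball {d} {v} start = centre∈ball d v
  reachable⇒∈ball (_▸_ {d} v⇝u (inj₁ refl)) = ⊇-original (layer d _) (reachable⇒∈ball v⇝u)
  reachable⇒∈ball (_▸_ {d} {w = w} v⇝u (inj₂ cuw)) =
    ⊇-joined (layer d _) (∈-allFin w) (reachable⇒∈ball v⇝u) cuw

covered? : ∀ {r k n} {φ : Colouring r k n} (ts : List (MonoTreeIn φ)) (x : Fin n) →
  Dec (Any (λ T → x ∈ vertices T) ts)
covered? ts x = any? (λ T → DecMembership._∈?_ Fin._≟_ x (vertices T)) ts

covered-or-missed : ∀ {r k n} {φ : Colouring r k n} (ts : List (MonoTreeIn φ)) →
  Covers φ ts ⊎ ∃ λ x → ¬ Any (λ T → x ∈ vertices T) ts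
covered-or-missed {n = n} ts with Fin.all? (covered? ts)
... | yes covers = inj₁ covers
... | no ¬covers = inj₂ (Fin.¬∀⟶∃¬ n _ (covered? ts) ¬covers)

balls-cover-or-miss : ∀ {r k n} (φ : Colouring r k n) (d : ℕ) (v : Fin n) (cs : List (Fin r)) →
  Covers φ (map (λ c → ball φ c d v) cs) ⊎ ∃ λ x → ∀ {c} → c ∈ cs → ¬ Reachable φ c v d x
balls-cover-or-miss φ d v cs with covered-or-missed (map (λ c → ball φ c d v) cs)
... | inj₁ covers = inj₁ covers
... | inj₂ (x , missed) = inj₂ (x , λ {c} c∈cs v⇝x → missed (map⁺ (lose c∈cs (reachable⇒∈ball φ c v⇝x))))

balls-tc≤ : ∀ {r k n m} (φ : Colouring r k n) d v (cs : List (Fin r)) → length cs ≤ m →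
  Covers φ (map (λ c → ball φ c d v) cs) → tc≤ φ m
balls-tc≤ φ d v cs len≤m covers = _ , ≤-trans (≤-reflexive (length-map _ cs)) len≤m , covers

missed⇒≢centre : ∀ {r k n} {φ : Colouring r k n} {d v u} {cs : List (Fin r)} → 1 ≤ length cs →
  (∀ {c} → c ∈ cs → ¬ Reachable φ c v d u) → v ≢ u
missed⇒≢centre {cs = c ∷ _} _ missed refl = missed (here refl) start

edge-has-colour : ∀ {r k n} (φ : Colouring r k n) → 1 ≤ k → ∀ {u w} → u ≢ w → ∃ λ c → c ∈ˢ col φ u w
edge-has-colour {r} {k} φ 1≤k {u} {w} u≢w with Subset.nonempty? (col φ u w)
... | yes nonempty = nonempty
... | no empty = contradiction k≡0 (m<n⇒n≢0 1≤k)
  where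
  k≡0 : k ≡ 0
  k≡0 = trans (≡-sym (size φ u w u≢w)) (trans (cong ∣_∣ (Subset.Empty-unique empty)) (Subset.∣⊥∣≡0 r))

𝟙 : Bool → ℕ
𝟙 true  = 1
𝟙 false = 0

𝟙≤1 : ∀ b → 𝟙 b ≤ 1
𝟙≤1 true  = ≤-refl
𝟙≤1 false = z≤n

T⇒1≤𝟙 : ∀ {b} → T b → 1 ≤ 𝟙 b
T⇒1≤𝟙 {true} _ = ≤-refl

𝟙+𝟙≤1 : ∀ a b → (T a → T b → ⊥) → 𝟙 a + 𝟙 b ≤ 1
𝟙+𝟙≤1 true  true  a⊥b = ⊥-elim (a⊥b _ _)
𝟙+𝟙≤1 true  false _   = ≤-refl
𝟙+𝟙≤1 false b     _   = 𝟙≤1 b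

𝟙-∨-disjoint : ∀ p q → (T p → T q → ⊥) → 𝟙 p + 𝟙 q ≤ 𝟙 (p ∨ q)
𝟙-∨-disjoint true  true  p⊥q = ⊥-elim (p⊥q _ _)
𝟙-∨-disjoint true  false _   = ≤-refl
𝟙-∨-disjoint false q     _   = ≤-refl

sum-mono-≤ : ∀ {n} {f g : Fin n → ℕ} → (∀ i → f i ≤ g i) → sum f ≤ sum g
sum-mono-≤ {zero}  f≤g = z≤n
sum-mono-≤ {suc n} f≤g = +-mono-≤ (f≤g zero) (sum-mono-≤ (f≤g ∘ suc))

sum-const : ∀ n x → sum {n} (λ _ → x) ≡ n * x
sum-const zero    x = refl
sum-const (suc n) x = cong (x +_) (sum-const n x)

∣p∣≡∑𝟙 : ∀ {n} (p : Subset n) → ∣ p ∣ ≡ sum (λ i → 𝟙 (lookup p i))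
∣p∣≡∑𝟙 []          = refl
∣p∣≡∑𝟙 (true ∷ p)  = cong suc (∣p∣≡∑𝟙 p)
∣p∣≡∑𝟙 (false ∷ p) = ∣p∣≡∑𝟙 p

T-lookup⇒∈ : ∀ {n} {p : Subset n} {i} → T (lookup p i) → i ∈ˢ p
T-lookup⇒∈ {p = p} {i} t = lookup⇒[]= i p (Equivalence.to T-≡ t)

triangle-budget : ∀ a b x p q →
  (T p → T a → ⊥) → (T q → T b → ⊥) → (T q → T a → T x → ⊥) → (T p → T b → T x → ⊥) →
  𝟙 a + 𝟙 b + 𝟙 x + 2 * 𝟙 (p ∨ q) ≤ 3
triangle-budget a     b     x false false _  _  _   _   =
  +-mono-≤ (+-mono-≤ (+-mono-≤ (𝟙≤1 a) (𝟙≤1 b)) (𝟙≤1 x)) z≤n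
triangle-budget true  b     x true  q     pa _  _   _   = ⊥-elim (pa _ _)
triangle-budget false b     x true  q     _  _  _   pbx = +-monoˡ-≤ 2 (𝟙+𝟙≤1 b x (pbx _))
triangle-budget a     true  x false true  _  qb _   _   = ⊥-elim (qb _ _)
triangle-budget false false x false true  _  _  _   _   = +-monoˡ-≤ 2 (𝟙≤1 x)
triangle-budget true  false x false true  _  _  qax _   = +-monoˡ-≤ 2 (𝟙+𝟙≤1 true x (qax _))

triangle-count : ∀ {r} (A B X : Subset r) (p q : Fin r → Bool) →
  (∀ c → T (p c) → c ∉ˢ A) → (∀ c → T (q c) → c ∉ˢ B) →
  (∀ c → T (q c) → c ∈ˢ A → c ∉ˢ X) → (∀ c → T (p c) → c ∈ˢ B → c ∉ˢ X) →
  ∣ A ∣ + ∣ B ∣ + ∣ X ∣ + 2 * sum (λ c → 𝟙 (p c ∨ q c)) ≤ 3 * r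
triangle-count {r} A B X p q pA qB qAX pBX = begin
  ∣ A ∣ + ∣ B ∣ + ∣ X ∣ + 2 * sum P
    ≡⟨ cong₂ _+_ (cong₂ _+_ (cong₂ _+_ (∣p∣≡∑𝟙 A) (∣p∣≡∑𝟙 B)) (∣p∣≡∑𝟙 X)) (*-distribˡ-sum 2 P) ⟩
  sum a + sum b + sum x + sum (λ c → 2 * P c)
    ≡⟨ ≡-sym (trans (∑-distrib-+ (λ c → a c + b c + x c) (λ c → 2 * P c))
                  (cong (_+ sum (λ c → 2 * P c)) (trans (∑-distrib-+ (λ c → a c + b c) x)
                                      (cong (_+ sum x) (∑-distrib-+ a b))))) ⟩
  sum (λ c → a c + b c + x c + 2 * P c)
    ≤⟨ sum-mono-≤ (λ c → triangle-budget (lookup A c) (lookup B c) (lookup X c) (p c) (q c)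
         (λ pc ac → pA c pc (T-lookup⇒∈ ac))
         (λ qc bc → qB c qc (T-lookup⇒∈ bc))
         (λ qc ac xc → qAX c qc (T-lookup⇒∈ ac) (T-lookup⇒∈ xc))
         (λ pc bc xc → pBX c pc (T-lookup⇒∈ bc) (T-lookup⇒∈ xc))) ⟩
  sum {r} (λ _ → 3)
    ≡⟨ trans (sum-const r 3) (*-comm r 3) ⟩
  3 * r ∎
  where
  open ≤-Reasoning
  a b x P : Fin r → ℕ
  a c = 𝟙 (lookup A c)
  b c = 𝟙 (lookup B c)
  x c = 𝟙 (lookup X c)
  P c = 𝟙 (p c ∨ q c)

sum-∨-disjoint : ∀ {r} (p q : Fin r → Bool) → (∀ c → T (p c) → T (q c) → ⊥) →
  sum (λ c → 𝟙 (p c)) + sum (λ c → 𝟙 (q c)) ≤ sum (λ c → 𝟙 (p c ∨ q c))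
sum-∨-disjoint p q p⊥q = begin
  sum (λ c → 𝟙 (p c)) + sum (λ c → 𝟙 (q c)) ≡⟨ ≡-sym (∑-distrib-+ (λ c → 𝟙 (p c)) (λ c → 𝟙 (q c))) ⟩
  sum (λ c → 𝟙 (p c) + 𝟙 (q c))             ≤⟨ sum-mono-≤ (λ c → 𝟙-∨-disjoint (p c) (q c) (p⊥q c)) ⟩
  sum (λ c → 𝟙 (p c ∨ q c))                 ∎
  where open ≤-Reasoning

sum-∨-exhaustive : ∀ {r} (p q : Fin r → Bool) → (∀ c → T (p c ∨ q c)) → r ≤ sum (λ c → 𝟙 (p c ∨ q c))
sum-∨-exhaustive {r} p q p∨q = ≤-trans (≤-reflexive (≡-sym (trans (sum-const r 1) (*-identityʳ r))))
                                       (sum-mono-≤ (λ c → T⇒1≤𝟙 (p∨q c)))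

-- Not a ≤ᵇ toℕ c: that does not reduce to a′ ≤ᵇ toℕ c′ on successors, as count-atLeast needs.
below atLeast : ∀ {r} → ℕ → Fin r → Bool
below   a c = toℕ c <ᵇ a
atLeast a c = not (toℕ c <ᵇ a)

T-not⁻ : ∀ {b} → T (not b) → ¬ T b
T-not⁻ {false} _ ()

T-not⁺ : ∀ {b} → ¬ T b → T (not b)
T-not⁺ {false} _ = _
T-not⁺ {true}  ¬t = ¬t _

below-atLeast-disjoint : ∀ {r a b} → a ≤ b → ∀ (c : Fin r) → T (below a c) → T (atLeast b c) → ⊥
below-atLeast-disjoint a≤b c c<a c≥b = T-not⁻ c≥b (<⇒<ᵇ (≤-trans (<ᵇ⇒< _ _ c<a) a≤b))

below-atLeast-exhaustive : ∀ {r a b} → b < a → ∀ (c : Fin r) → T (below a c ∨ atLeast b c)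
below-atLeast-exhaustive {b = b} b<a c with toℕ c <? b
... | yes c<b = Equivalence.from T-∨ (inj₁ (<⇒<ᵇ (<-trans c<b b<a)))
... | no c≮b  = Equivalence.from T-∨ (inj₂ (T-not⁺ (c≮b ∘ <ᵇ⇒< _ _)))

count-below : ∀ {r a} → a ≤ r → sum (λ (c : Fin r) → 𝟙 (below a c)) ≡ a
count-below {zero}  z≤n = refl
count-below {suc r} z≤n = trans (sum-const r 0) (*-zeroʳ r)
count-below {suc r} (s≤s a≤r) = cong suc (count-below a≤r)

count-atLeast : ∀ a b → sum (λ (c : Fin (a + b)) → 𝟙 (atLeast a c)) ≡ b
count-atLeast zero    b = trans (sum-const b 1) (*-identityʳ b)
count-atLeast (suc a) b = count-atLeast a b

length-filter-tabulate : ∀ {A : Set} {n} (p : A → Bool) (f : Fin n → A) →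
  length (filter (T? ∘ p) (tabulate f)) ≡ sum (λ i → 𝟙 (p (f i)))
length-filter-tabulate {n = zero}  p f = refl
length-filter-tabulate {n = suc n} p f with p (f zero)
... | true  = cong suc (length-filter-tabulate p (f ∘ suc))
... | false = length-filter-tabulate p (f ∘ suc)

colours : ∀ {r} → (Fin r → Bool) → List (Fin r)
colours p = filter (T? ∘ p) (allFin _)

∈-colours : ∀ {r} {p : Fin r → Bool} {c} → T (p c) → c ∈ colours p
∈-colours {c = c} pc = ∈-filter⁺ (T? ∘ _) (∈-allFin c) pc

length-colours : ∀ {r} (p : Fin r → Bool) → length (colours p) ≡ sum (λ c → 𝟙 (p c))
length-colours p = length-filter-tabulate p id

length-colours-below : ∀ {r a} → a ≤ r → length (colours {r} (below a)) ≡ a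
length-colours-below {r} {a} a≤r = trans (length-colours {r} (below a)) (count-below a≤r)

length-colours-atLeast : ∀ a b → length (colours {a + b} (atLeast a)) ≡ b
length-colours-atLeast a b = trans (length-colours {a + b} (atLeast a)) (count-atLeast a b)

missed-pair-bound : ∀ {r k n} (φ : Colouring r k n) {v u₀ u₁ : Fin n} (p q : Fin r → Bool) →
  (∀ c → T (p c) → ¬ Reachable φ c v 2 u₀) →
  (∀ c → T (q c) → ¬ Reachable φ c v 2 u₁) →
  v ≢ u₀ → v ≢ u₁ →
  k + k + k + 2 * sum (λ c → 𝟙 (p c ∨ q c)) ≤ 3 * r
missed-pair-bound {r} {k} φ {v} {u₀} {u₁} p q miss₀ miss₁ v≢u₀ v≢u₁ with u₀ Fin.≟ u₁
-- If u₀ = u₁, the triangle collapses to the edge vu₀, counted three times.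
... | yes refl = subst (λ s → s + 2 * N ≤ 3 * r) (cong₂ _+_ (cong₂ _+_ ∣A∣ ∣A∣) ∣A∣)
  (triangle-count A A A p q pA qB (λ c qc c∈A _ → qB c qc c∈A) (λ c pc c∈A _ → pA c pc c∈A))
  where
  A : Subset r
  A = col φ v u₀
  N : ℕ
  N = sum (λ c → 𝟙 (p c ∨ q c))
  ∣A∣ : ∣ A ∣ ≡ k
  ∣A∣ = size φ v u₀ v≢u₀
  pA : ∀ c → T (p c) → c ∉ˢ A
  pA c pc c∈A = miss₀ c pc (start ▸ inj₂ c∈A)
  qB : ∀ c → T (q c) → c ∉ˢ A
  qB c qc c∈A = miss₁ c qc (start ▸ inj₂ c∈A)
... | no u₀≢u₁ = subst (λ s → s + 2 * N ≤ 3 * r)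
  (cong₂ _+_ (cong₂ _+_ (size φ v u₀ v≢u₀) (size φ v u₁ v≢u₁)) (size φ u₀ u₁ u₀≢u₁))
  (triangle-count (col φ v u₀) (col φ v u₁) (col φ u₀ u₁) p q
    (λ c pc c∈A → miss₀ c pc (start ▸ inj₂ c∈A))
    (λ c qc c∈B → miss₁ c qc (start ▸ inj₂ c∈B))
    (λ c qc c∈A c∈X → miss₁ c qc (start ▸ inj₂ c∈A ▸ inj₂ c∈X))
    (λ c pc c∈B c∈X → miss₀ c pc (start ▸ inj₂ c∈B ▸ joined-sym φ c (inj₂ c∈X))))
  where
  N : ℕ
  N = sum (λ c → 𝟙 (p c ∨ q c))

cancel-k+k+k : ∀ k m N → k + k + k + 2 * N ≤ 3 * (k + m) → 2 * N ≤ 3 * m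
cancel-k+k+k k m N le = +-cancelˡ-≤ (k + k + k) (2 * N) (3 * m) (≤-trans le (≤-reflexive (expand k m)))
  where
  expand : ∀ k m → 3 * (k + m) ≡ k + k + k + 3 * m
  expand = solve-∀

disjoint-families-overfull : ∀ m N → 1 ≤ m → m + m ≤ N → 2 * N ≤ 3 * m → ⊥
disjoint-families-overfull m N 1≤m 2m≤N 2N≤3m = <⇒≱ (m<m+n (3 * m) 1≤m) (begin
  3 * m + m     ≡⟨ expand m ⟩
  2 * (m + m)   ≤⟨ *-monoʳ-≤ 2 2m≤N ⟩
  2 * N         ≤⟨ 2N≤3m ⟩
  3 * m         ∎)
  where
  open ≤-Reasoning
  expand : ∀ m → 3 * m + m ≡ 2 * (m + m)
  expand = solve-∀

exhaustive-families⇒k,m≡1,2 : ∀ k m → 1 ≤ k → m ≤ suc k → 2 * (k + m) ≤ 3 * m → k ≡ 1 × m ≡ 2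
exhaustive-families⇒k,m≡1,2 k m 1≤k m≤1+k le =
  ≤-antisym k≤1 1≤k , ≤-antisym (≤-trans m≤1+k (s≤s k≤1)) (≤-trans (*-monoʳ-≤ 2 1≤k) 2k≤m)
  where
  2k≤m : 2 * k ≤ m
  2k≤m = +-cancelʳ-≤ (2 * m) (2 * k) m
           (≤-trans (≤-reflexive (expandˡ k m)) (≤-trans le (≤-reflexive (expandʳ m))))
    where
    expandˡ : ∀ k m → 2 * k + 2 * m ≡ 2 * (k + m)
    expandˡ = solve-∀
    expandʳ : ∀ m → 3 * m ≡ m + 2 * m
    expandʳ = solve-∀
  k≤1 : k ≤ 1
  k≤1 = +-cancelʳ-≤ k k 1 (≤-trans (≤-reflexive (double k)) (≤-trans 2k≤m m≤1+k))
    where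
    double : ∀ k → k + k ≡ 2 * k
    double = solve-∀

tcK≤-two-families : ∀ k m → 1 ≤ k → 1 ≤ m → m ≤ suc k → ¬ (k ≡ 1 × m ≡ 2) →
  ∀ n → 1 ≤ n → tcK≤ (k + m) k n m
tcK≤-two-families k m 1≤k 1≤m m≤1+k k,m≢1,2 (suc n) _ φ
  with balls-cover-or-miss φ 2 zero (colours (below m)) | balls-cover-or-miss φ 2 zero (colours (atLeast k))
... | inj₁ covers | _ =
  balls-tc≤ φ 2 zero (colours (below m)) (≤-reflexive (length-colours-below (m≤n+m m k))) covers
... | _ | inj₁ covers =
  balls-tc≤ φ 2 zero (colours (atLeast k)) (≤-reflexive (length-colours-atLeast k m)) covers
... | inj₂ (u₀ , miss₀) | inj₂ (u₁ , miss₁) = ⊥-elim overfull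
  where
  N : ℕ
  N = sum (λ (c : Fin (k + m)) → 𝟙 (below m c ∨ atLeast k c))
  2N≤3m : 2 * N ≤ 3 * m
  2N≤3m = cancel-k+k+k k m N (missed-pair-bound φ (below m) (atLeast k)
    (λ _ → miss₀ ∘ ∈-colours) (λ _ → miss₁ ∘ ∈-colours)
    (missed⇒≢centre (≤-trans 1≤m (≤-reflexive (≡-sym (length-colours-below (m≤n+m m k))))) miss₀)
    (missed⇒≢centre (≤-trans 1≤m (≤-reflexive (≡-sym (length-colours-atLeast k m)))) miss₁))
  overfull : ⊥
  overfull with m ≤? k
  ... | yes m≤k = disjoint-families-overfull m N 1≤m
    (≤-trans (≤-reflexive (cong₂ _+_ (≡-sym (count-below (m≤n+m m k))) (≡-sym (count-atLeast k m))))
             (sum-∨-disjoint {k + m} (below m) (atLeast k) (below-atLeast-disjoint m≤k)))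
    2N≤3m
  ... | no m≰k = k,m≢1,2 (exhaustive-families⇒k,m≡1,2 k m 1≤k m≤1+k
    (≤-trans (*-monoʳ-≤ 2 (sum-∨-exhaustive {k + m} (below m) (atLeast k) (below-atLeast-exhaustive (≰⇒> m≰k))))
             2N≤3m))

joined-in-some-colour : ∀ {n} (φ : Colouring 3 1 n) u w → ∃ λ c → Joined φ c u w
joined-in-some-colour φ u w with u Fin.≟ w
... | yes u≡w = 0F , inj₁ u≡w
... | no u≢w  = let c , c∈uw = edge-has-colour φ ≤-refl u≢w in c , inj₂ c∈uw

two-balls-cover : ∀ {n} (φ : Colouring 3 1 n) {v x₀ x₁ x₂ : Fin n} →
  ¬ Reachable φ 1F v 3 x₀ → ¬ Reachable φ 2F v 3 x₀ →
  ¬ Reachable φ 0F v 3 x₁ → ¬ Reachable φ 2F v 3 x₁ →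
  ¬ Reachable φ 0F v 3 x₂ → ¬ Reachable φ 1F v 3 x₂ →
  Covers φ (ball φ 0F 3 v ∷ ball φ 0F 3 x₁ ∷ [])
two-balls-cover φ {v} {x₀} {x₁} {x₂} ¬1x₀ ¬2x₀ ¬0x₁ ¬2x₁ ¬0x₂ ¬1x₂ = covers
  where
  colourOf : ∀ u w → ∃ λ c → Joined φ c u w
  colourOf = joined-in-some-colour φ
  rev : ∀ {c u w} → Joined φ c u w → Joined φ c w u
  rev = joined-sym φ _

  v─x₀ : Joined φ 0F v x₀
  v─x₀ with colourOf v x₀
  ... | 0F , j = j
  ... | 1F , j = ⊥-elim (¬1x₀ (start ▸ j))
  ... | 2F , j = ⊥-elim (¬2x₀ (start ▸ j))

  v─x₁ : Joined φ 1F v x₁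
  v─x₁ with colourOf v x₁
  ... | 0F , j = ⊥-elim (¬0x₁ (start ▸ j))
  ... | 1F , j = j
  ... | 2F , j = ⊥-elim (¬2x₁ (start ▸ j))

  v─x₂ : Joined φ 2F v x₂
  v─x₂ with colourOf v x₂
  ... | 0F , j = ⊥-elim (¬0x₂ (start ▸ j))
  ... | 1F , j = ⊥-elim (¬1x₂ (start ▸ j))
  ... | 2F , j = j

  x₁─x₂ : Joined φ 0F x₁ x₂
  x₁─x₂ with colourOf x₁ x₂
  ... | 0F , j = j
  ... | 1F , j = ⊥-elim (¬1x₂ (start ▸ v─x₁ ▸ j))
  ... | 2F , j = ⊥-elim (¬2x₁ (start ▸ v─x₂ ▸ rev j))

  Covered : Fin _ → Set
  Covered g = Any (λ T → g ∈ vertices T) (ball φ 0F 3 v ∷ ball φ 0F 3 x₁ ∷ [])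

  inA : ∀ {g} → Reachable φ 0F v 3 g → Covered g
  inA = here ∘ reachable⇒∈ball φ 0F
  inB : ∀ {g} → Reachable φ 0F x₁ 3 g → Covered g
  inB = there ∘ here ∘ reachable⇒∈ball φ 0F

  covers : ∀ g → Covered g
  covers g with colourOf v g
  ... | 0F , v─g = inA (start ▸ v─g)
  ... | 1F , v─g with colourOf x₀ g
  ...   | 0F , x₀─g = inA (start ▸ v─x₀ ▸ x₀─g)
  ...   | 1F , x₀─g = ⊥-elim (¬1x₀ (start ▸ v─g ▸ rev x₀─g))
  ...   | 2F , x₀─g with colourOf x₂ g
  ...     | 0F , x₂─g = inB (start ▸ x₁─x₂ ▸ x₂─g)
  ...     | 1F , x₂─g = ⊥-elim (¬1x₂ (start ▸ v─g ▸ rev x₂─g))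
  ...     | 2F , x₂─g = ⊥-elim (¬2x₀ (start ▸ v─x₂ ▸ x₂─g ▸ rev x₀─g))
  covers g | 2F , v─g with colourOf x₀ g
  ...   | 0F , x₀─g = inA (start ▸ v─x₀ ▸ x₀─g)
  ...   | 2F , x₀─g = ⊥-elim (¬2x₀ (start ▸ v─g ▸ rev x₀─g))
  ...   | 1F , x₀─g with colourOf x₁ g
  ...     | 0F , x₁─g = inB (start ▸ x₁─g)
  ...     | 2F , x₁─g = ⊥-elim (¬2x₁ (start ▸ v─g ▸ rev x₁─g))
  ...     | 1F , x₁─g = ⊥-elim (¬1x₀ (start ▸ v─x₁ ▸ x₁─g ▸ rev x₀─g))

tcK≤-3,1 : ∀ n → 1 ≤ n → tcK≤ 3 1 n 2
tcK≤-3,1 (suc n) _ φ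
  with balls-cover-or-miss φ 3 zero (0F ∷ 1F ∷ []) | balls-cover-or-miss φ 3 zero (1F ∷ 2F ∷ [])
     | balls-cover-or-miss φ 3 zero (0F ∷ 2F ∷ [])
... | inj₁ covers | _ | _ = balls-tc≤ φ 3 zero (0F ∷ 1F ∷ []) ≤-refl covers
... | _ | inj₁ covers | _ = balls-tc≤ φ 3 zero (1F ∷ 2F ∷ []) ≤-refl covers
... | _ | _ | inj₁ covers = balls-tc≤ φ 3 zero (0F ∷ 2F ∷ []) ≤-refl covers
... | inj₂ (x₂ , miss₂) | inj₂ (x₀ , miss₀) | inj₂ (x₁ , miss₁) =
  _ , ≤-refl , two-balls-cover φ (miss₀ (here refl)) (miss₀ (there (here refl)))
                                 (miss₁ (here refl)) (miss₁ (there (here refl)))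
                                 (miss₂ (here refl)) (miss₂ (there (here refl)))

tcK≤-k+m : ∀ k m → 1 ≤ k → 1 ≤ m → m ≤ suc k → ∀ n → 1 ≤ n → tcK≤ (k + m) k n m
tcK≤-k+m k m 1≤k 1≤m m≤1+k with k ≟ 1 | m ≟ 2
... | yes refl | yes refl = tcK≤-3,1
... | no k≢1   | _        = tcK≤-two-families k m 1≤k 1≤m m≤1+k (k≢1 ∘ proj₁)
... | _        | no m≢2   = tcK≤-two-families k m 1≤k 1≤m m≤1+k (m≢2 ∘ proj₂)

r∸k≤1+k : ∀ {r k} → k ≤ r → r ∸ 1 ≤ 2 * k → r ∸ k ≤ suc k
r∸k≤1+k {r} {k} k≤r r∸1≤2k = +-cancelˡ-≤ k (r ∸ k) (suc k) (begin
  k + (r ∸ k)  ≡⟨ m+[n∸m]≡n k≤r ⟩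
  r            ≤⟨ m≤n+m∸n r 1 ⟩
  suc (r ∸ 1)  ≤⟨ s≤s r∸1≤2k ⟩
  suc (2 * k)  ≡⟨ rearrange k ⟩
  k + suc k    ∎)
  where
  open ≤-Reasoning
  rearrange : ∀ k → suc (2 * k) ≡ k + suc k
  rearrange = solve-∀

lemma5p3 : (r k : ℕ) → k < r → 1 ≤ k → r ∸ 1 ≤ 2 * k →
    (n : ℕ) → 1 ≤ n → tcK≤ r k n (r ∸ k)
lemma5p3 r k k<r 1≤k r∸1≤2k n 1≤n =
  subst (λ r′ → tcK≤ r′ k n (r ∸ k)) (m+[n∸m]≡n (<⇒≤ k<r))
    (tcK≤-k+m k (r ∸ k) 1≤k (m<n⇒0<n∸m k<r) (r∸k≤1+k (<⇒≤ k<r) r∸1≤2k) n 1≤n)
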